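{- Let $G$ and $H$ be graphs with the same number of vertices such that $\delta(G)\ge 2$ and $\delta(H)\ge 1$. Let $M(G,H)$ denote a graph obtained from disjoint copies of $G$ and $H$ by adding a perfect matching between $V(G)$ and $V(H)$. Then $\mathcal{R}(M(G,H))$ has an isolated vertex.
   Context: All graphs are finite, simple and undirected; $N(v)$ denotes the open neighbourhood of $v$ and $\delta$ the minimum degree. A set $S\subseteq V(G)$ is a dominating set if every vertex of $G$ is in $S$ or adjacent to a vertex of $S$; it is a minimal dominating set if no proper subset of $S$ is a dominating set. The reconfiguration graph $\mathcal{R}(G)$ has as vertex set the collection of all minimal dominating sets of $G$, and two minimal dominating sets $M_1,M_2$ are adjacent iff there is a vertex $v$ with either ($M_2\setminus M_1=\{v\}$ and $M_1\setminus M_2\subseteq N(v)$) or ($M_1\setminus M_2=\{v\}$ and $M_2\setminus M_1\subseteq N(v)$). -}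

module Defs where

open import Data.Nat using (ℕ; _≤_)
open import Data.Fin using (Fin)
open import Data.Sum using (_⊎_; inj₁; inj₂)
open import Data.Product using (_×_; Σ; ∃; ∃-syntax; _,_)
open import Data.Empty using (⊥)
open import Data.Unit using (⊤)
open import Relation.Nullary using (¬_)
open import Relation.Binary.PropositionalEquality using (_≡_)
open import Function.Bundles using (_↔_; Inverse)
open import Level using (0ℓ)

record Graph (V : Set) : Set₁ where
  field
    Adj   : V → V → Set
    sym   : ∀ {u v} → Adj u v → Adj v u
    irrefl : ∀ {v} → ¬ Adj v v
open Graph public

FinGraph : ℕ → Set₁
FinGraph n = Graph (Fin n)

VSet : Set → Set₁
VSet V = V → Set

-- degree / minimum degree: δ(G) ≥ k  iff every vertex has at least k
-- distinct neighbours.  For a finite graph, "v has ≥ k neighbours" means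
-- there is an injective family of k neighbours of v.
HasDegAtLeast : ∀ {n} → FinGraph n → ℕ → Fin n → Set
HasDegAtLeast {n} G k v =
  Σ (Fin k → Fin n) λ f →
    (∀ i j → f i ≡ f j → i ≡ j) × (∀ i → Adj G v (f i))

MinDegAtLeast : ∀ {n} → FinGraph n → ℕ → Set
MinDegAtLeast G k = ∀ v → HasDegAtLeast G k v

module _ {V : Set} (G : Graph V) where

  Dominating : VSet V → Set
  Dominating S = ∀ v → S v ⊎ ∃[ u ] (S u × Adj G v u)

  MinimalDominating : VSet V → Set₁
  MinimalDominating S =
    Dominating S ×
    (∀ (T : VSet V) → (∀ v → T v → S v) → (∃[ w ] (S w × ¬ T w)) → ¬ Dominating T)

  Step : VSet V → VSet V → V → Set
  Step M₁ M₂ v =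
    (∀ w → (M₂ w × ¬ M₁ w) → w ≡ v) × (M₂ v × ¬ M₁ v) ×
    (∀ w → (M₁ w × ¬ M₂ w) → Adj G v w)

  RAdj : VSet V → VSet V → Set
  RAdj M₁ M₂ = ∃[ v ] (Step M₁ M₂ v ⊎ Step M₂ M₁ v)

  IsolatedInR : VSet V → Set₁
  IsolatedInR M = MinimalDominating M ×
    (∀ (M' : VSet V) → MinimalDominating M' → ¬ RAdj M M')

  HasIsolatedInR : Set₁
  HasIsolatedInR = Σ (VSet V) IsolatedInR

MatchAdj : ∀ {n} → FinGraph n → FinGraph n → (Fin n → Fin n) →
           Fin n ⊎ Fin n → Fin n ⊎ Fin n → Set
MatchAdj G H σ (inj₁ a) (inj₁ b) = Adj G a b
MatchAdj G H σ (inj₂ a) (inj₂ b) = Adj H a b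
MatchAdj G H σ (inj₁ a) (inj₂ b) = σ a ≡ b
MatchAdj G H σ (inj₂ a) (inj₁ b) = σ b ≡ a

private
  matchSym : ∀ {n} (G H : FinGraph n) (σ : Fin n → Fin n) {u v} →
             MatchAdj G H σ u v → MatchAdj G H σ v u
  matchSym G H σ {inj₁ a} {inj₁ b} p = sym G p
  matchSym G H σ {inj₂ a} {inj₂ b} p = sym H p
  matchSym G H σ {inj₁ a} {inj₂ b} p = p
  matchSym G H σ {inj₂ a} {inj₁ b} p = p

  matchIrr : ∀ {n} (G H : FinGraph n) (σ : Fin n → Fin n) {v} →
             ¬ MatchAdj G H σ v v
  matchIrr G H σ {inj₁ a} = irrefl G
  matchIrr G H σ {inj₂ a} = irrefl H

MGH : ∀ {n} → FinGraph n → FinGraph n → (Fin n ↔ Fin n) → Graph (Fin n ⊎ Fin n)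
MGH G H σ = record
  { Adj = MatchAdj G H (Inverse.to σ)
  ; sym = λ {u} {v} → matchSym G H (Inverse.to σ) {u} {v}
  ; irrefl = λ {v} → matchIrr G H (Inverse.to σ) {v}
  }

{-# OPTIONS --safe #-}
module Submission where

-- The left side L = V(G) is an isolated vertex of R.  Each σ x is dominated by
-- x alone, so L is minimal.  A minimal dominating set M adjacent to L contains
-- L − a + σ a for some a.  If a ∈ M, then M strictly contains the dominating set
-- L.  If a ∉ M, pick an H-neighbour b of σ a: the partner σ⁻¹ b is redundant in
-- M, since δ(G) ≥ 2 dominates a and σ⁻¹ b by other left vertices and b is
-- dominated by σ a.  Membership in M is decidable only under double negation,
-- which suffices as the goal is ⊥.

open import Defs hiding (sym)
open import Data.Nat using (ℕ)
open import Data.Fin using (Fin; zero; suc; _≟_)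
open import Data.Fin.Properties using (0≢1+n; sequence)
open import Data.Sum using (_⊎_; inj₁; inj₂)
open import Data.Sum.Properties using (inj₁-injective)
open import Data.Product using (_×_; ∃-syntax; _,_; proj₁; proj₂)
open import Data.Empty using (⊥; ⊥-elim)
open import Data.Unit using (⊤; tt)
open import Effect.Monad using (RawMonad)
open import Function using (_∘_; flip)
open import Function.Bundles using (_↔_; Inverse; Injection)
open import Function.Properties.Inverse using (↔⇒↣)
open import Function.Construct.Symmetry using (↔-sym)
open import Relation.Nullary using (¬_; yes; no; ¬¬-excluded-middle)
open import Relation.Nullary.Negation using (¬¬-Monad)
open import Relation.Unary using (Pred; Decidable; _⊆_; _∖_; ｛_｝)
open import Relation.Binary.PropositionalEquality
  using (_≡_; _≢_; refl; sym; trans; subst)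

¬¬-decidable : ∀ {p n} (P : Pred (Fin n) p) → ¬ ¬ Decidable P
¬¬-decidable P = sequence rawApplicative (λ _ → ¬¬-excluded-middle)
  where open RawMonad ¬¬-Monad using (rawApplicative)

degree≥2⇒neighbour-≢ : ∀ {n} (G : FinGraph n) {x} → HasDegAtLeast G 2 x →
                       ∀ y → ∃[ g ] Adj G x g × g ≢ y
degree≥2⇒neighbour-≢ G (f , injective , adjacent) y with f zero ≟ y
... | no f₀≢y = f zero , adjacent zero , f₀≢y
... | yes f₀≡y = f (suc zero) , adjacent (suc zero) ,
                 λ f₁≡y → 0≢1+n (injective zero (suc zero) (trans f₀≡y (sym f₁≡y)))

neighbour-≢ : ∀ {V} (G : Graph V) {x g} → Adj G x g → g ≢ x
neighbour-≢ G x~g refl = irrefl G x~g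

minimalDominating⇒¬dominating-∖ : ∀ {V} (G : Graph V) {S w} →
  MinimalDominating G S → S w → ¬ Dominating G (S ∖ ｛ w ｝)
minimalDominating⇒¬dominating-∖ G {S} {w} (_ , minimal) w∈S =
  minimal (S ∖ ｛ w ｝) (λ _ → proj₁) (w , w∈S , λ (_ , w≢w) → w≢w refl)

module Matching {n : ℕ} (G H : FinGraph n) (σ : Fin n ↔ Fin n) where

  open Inverse σ using (to; from; strictlyInverseˡ; inverseˡ; inverseʳ)

  K : Graph (Fin n ⊎ Fin n)
  K = MGH G H σ

  to-injective : ∀ {x y} → to x ≡ to y → x ≡ y
  to-injective = Injection.injective (↔⇒↣ σ)

  from-injective : ∀ {x y} → from x ≡ from y → x ≡ y
  from-injective = Injection.injective (↔⇒↣ (↔-sym σ))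

  Left : VSet (Fin n ⊎ Fin n)
  Left (inj₁ _) = ⊤
  Left (inj₂ _) = ⊥

  Left-exchange : Fin n → VSet (Fin n ⊎ Fin n)
  Left-exchange a (inj₁ x) = x ≢ a
  Left-exchange a (inj₂ c) = c ≡ to a

  Left-dominating : Dominating K Left
  Left-dominating (inj₁ _) = inj₁ tt
  Left-dominating (inj₂ c) = inj₂ (inj₁ (from c) , tt , strictlyInverseˡ c)

  Left-minimalDominating : MinimalDominating K Left
  Left-minimalDominating = Left-dominating , minimal
    where
    minimal : ∀ T → (∀ v → T v → Left v) → ∃[ w ] (Left w × ¬ T w) → ¬ Dominating K T
    minimal T T⊆Left (inj₁ x , _ , x∉T) T-dominating with T-dominating (inj₂ (to x))
    ... | inj₁ σx∈T = T⊆Left _ σx∈T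
    ... | inj₂ (inj₂ _ , c∈T , _) = T⊆Left _ c∈T
    ... | inj₂ (inj₁ y , y∈T , σy≡σx) =
          x∉T (subst (T ∘ inj₁) (to-injective σy≡σx) y∈T)

  step-from-Left⇒⊇Left-exchange : ∀ {M v} → Decidable (M ∘ inj₁) → Step K Left M v →
                                   ∃[ a ] Left-exchange a ⊆ M
  step-from-Left⇒⊇Left-exchange {v = inj₁ _} _ (_ , (_ , v∉Left) , _) = ⊥-elim (v∉Left tt)
  step-from-Left⇒⊇Left-exchange {M} {inj₂ b} M? (_ , (b∈M , _) , Left∖M⊆N[b]) =
    from b , exchange⊆M
    where
    exchange⊆M : Left-exchange (from b) ⊆ M
    exchange⊆M {inj₁ x} x≢σ⁻¹b with M? x
    ... | yes x∈M = x∈M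
    ... | no x∉M = ⊥-elim (x≢σ⁻¹b (sym (inverseʳ (sym σx≡b))))
      where
      σx≡b : to x ≡ b
      σx≡b = Left∖M⊆N[b] (inj₁ x) (tt , x∉M)
    exchange⊆M {inj₂ c} c≡σσ⁻¹b =
      subst (M ∘ inj₂) (sym (trans c≡σσ⁻¹b (strictlyInverseˡ b))) b∈M

  step-to-Left⇒⊇Left-exchange : ∀ {M v} → Decidable (M ∘ inj₁) → Dominating K M →
                                 Step K M Left v → ∃[ a ] Left-exchange a ⊆ M
  step-to-Left⇒⊇Left-exchange {v = inj₂ _} _ _ (_ , (() , _) , _)
  step-to-Left⇒⊇Left-exchange {M} {inj₁ a} M? M-dominating
                              (Left∖M⊆[a] , (_ , a∉M) , M∖Left⊆N[a]) = a , exchange⊆M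
    where
    σa∈M : M (inj₂ (to a))
    σa∈M with M-dominating (inj₂ (to a))
    ... | inj₁ σa∈M = σa∈M
    ... | inj₂ (inj₁ y , y∈M , σy≡σa) =
          ⊥-elim (a∉M (subst (M ∘ inj₁) (to-injective σy≡σa) y∈M))
    ... | inj₂ (inj₂ c , c∈M , _) =
          subst (M ∘ inj₂) (sym (M∖Left⊆N[a] (inj₂ c) (c∈M , λ ()))) c∈M

    exchange⊆M : Left-exchange a ⊆ M
    exchange⊆M {inj₁ x} x≢a with M? x
    ... | yes x∈M = x∈M
    ... | no x∉M = ⊥-elim (x≢a (inj₁-injective (Left∖M⊆[a] (inj₁ x) (tt , x∉M))))
    exchange⊆M {inj₂ c} refl = σa∈M

  RAdj-Left⇒⊇Left-exchange : ∀ {M} → Decidable (M ∘ inj₁) → Dominating K M →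
                               RAdj K Left M → ∃[ a ] Left-exchange a ⊆ M
  RAdj-Left⇒⊇Left-exchange M? _ (_ , inj₁ step) = step-from-Left⇒⊇Left-exchange M? step
  RAdj-Left⇒⊇Left-exchange M? M-dominating (_ , inj₂ step) =
    step-to-Left⇒⊇Left-exchange M? M-dominating step

  module _ (δG≥2 : MinDegAtLeast G 2) (δH≥1 : MinDegAtLeast H 1) where

    ¬minimalDominating-⊇Left-exchange-∌ : ∀ {M a} → MinimalDominating K M →
      Left-exchange a ⊆ M → ¬ M (inj₁ a) → ⊥
    ¬minimalDominating-⊇Left-exchange-∌ {M} {a} M-minimal exchange⊆M a∉M =
      minimalDominating⇒¬dominating-∖ K M-minimal (exchange⊆M a'≢a) T-dominating
      where
      b : Fin n
      b = proj₁ (δH≥1 (to a)) zero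

      σa~b : Adj H (to a) b
      σa~b = proj₂ (proj₂ (δH≥1 (to a))) zero

      a' : Fin n
      a' = from b

      a'≢a : a' ≢ a
      a'≢a a'≡a = irrefl H (subst (Adj H (to a)) (sym (inverseˡ (sym a'≡a))) σa~b)

      T : VSet (Fin n ⊎ Fin n)
      T = M ∖ ｛ inj₁ a' ｝

      left∈T : ∀ {x} → x ≢ a → x ≢ a' → T (inj₁ x)
      left∈T x≢a x≢a' = exchange⊆M x≢a , λ a'≡x → x≢a' (sym (inj₁-injective a'≡x))

      dominated-by-neighbour : ∀ {x y} → (∀ {z} → z ≢ x → z ≢ y → T (inj₁ z)) →
                               ∃[ u ] (T u × Adj K (inj₁ x) u)
      dominated-by-neighbour {x} {y} avoiding⇒∈T with degree≥2⇒neighbour-≢ G (δG≥2 x) y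
      ... | g , x~g , g≢y = inj₁ g , avoiding⇒∈T (neighbour-≢ G x~g) g≢y , x~g

      T-dominating : Dominating K T
      T-dominating (inj₁ x) with x ≟ a | x ≟ a'
      ... | yes refl | _ = inj₂ (dominated-by-neighbour left∈T)
      ... | no _ | yes refl = inj₂ (dominated-by-neighbour (flip left∈T))
      ... | no x≢a | no x≢a' = inj₁ (left∈T x≢a x≢a')
      T-dominating (inj₂ c) with c ≟ to a | c ≟ b
      ... | yes c≡σa | _ = inj₁ (exchange⊆M c≡σa , λ ())
      ... | no _ | yes refl = inj₂ (inj₂ (to a) , (exchange⊆M refl , λ ()) , Graph.sym H σa~b)
      ... | no c≢σa | no c≢b =
            inj₂ (inj₁ (from c) ,
                  left∈T (λ σ⁻¹c≡a → c≢σa (sym (inverseˡ (sym σ⁻¹c≡a))))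
                         (λ σ⁻¹c≡a' → c≢b (from-injective σ⁻¹c≡a')) ,
                  strictlyInverseˡ c)

    ¬minimalDominating-⊇Left-exchange : ∀ {M a} → MinimalDominating K M →
      Left-exchange a ⊆ M → ⊥
    ¬minimalDominating-⊇Left-exchange {M} {a} M-minimal exchange⊆M = ¬¬-excluded-middle λ
      { (yes a∈M) → proj₂ M-minimal Left (Left⊆M a∈M) (inj₂ (to a) , exchange⊆M refl , λ ())
                      Left-dominating
      ; (no a∉M) → ¬minimalDominating-⊇Left-exchange-∌ M-minimal exchange⊆M a∉M }
      where
      Left⊆M : M (inj₁ a) → ∀ v → Left v → M v
      Left⊆M a∈M (inj₁ x) _ with x ≟ a
      ... | yes refl = a∈M
      ... | no x≢a = exchange⊆M x≢a

    Left-isolated : IsolatedInR K Left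
    Left-isolated = Left-minimalDominating , λ M M-minimal Left~M →
      ¬¬-decidable (M ∘ inj₁) λ M? →
        let (_ , exchange⊆M) = RAdj-Left⇒⊇Left-exchange M? (proj₁ M-minimal) Left~M
        in ¬minimalDominating-⊇Left-exchange M-minimal exchange⊆M

theorem13 : ∀ (n : ℕ) (G H : FinGraph n) (σ : Fin n ↔ Fin n) →
    MinDegAtLeast G 2 → MinDegAtLeast H 1 →
    HasIsolatedInR (MGH G H σ)
theorem13 n G H σ δG≥2 δH≥1 = Left , Left-isolated δG≥2 δH≥1
  where open Matching G H σ
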